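{- Let $n\ge 1$, let $F(n)$ be the free five-valued Nelson algebra with set of free generators $G=\{g_1,\dots,g_n\}$, and let $C_5=\{0,\tfrac14,\tfrac12,\tfrac34,1\}$. For $f\colon G\to C_5$ let $\bar f\colon F(n)\to C_5$ be the unique homomorphism extending $f$, put $P_f=\{x\in F(n):\bar f(x)=1\}$ and $f_i=f(g_i)$. Then for $f,h\colon G\to C_5$ we have $P_h\subsetneq P_f$ if and only if all the following hold: (1) $f_i\in\{0,\tfrac12,1\}$ for every $i$; (2) $f_i\neq h_i$ for at least one $i$; (3) for every $i$, if $f_i=0$ then $h_i\in\{0,\tfrac14\}$; (4) for every $i$, if $f_i=1$ then $h_i\in\{1,\tfrac34\}$; (5) for every $i$, $h_i=\tfrac12$ if and only if $f_i=\tfrac12$.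
   Context: A Nelson algebra is an algebra $(N,1,\sim,\wedge,\vee,\to)$ of type $(0,1,2,2,2)$ satisfying, for all $x,y,z$: $x\wedge(x\vee y)=x$; $x\wedge(y\vee z)=(z\wedge x)\vee(y\wedge x)$; $\sim\sim x=x$; $\sim(x\vee y)=\sim x\vee\sim y$; $x\wedge\sim x=(x\wedge\sim x)\wedge(y\vee\sim y)$; $x\to x=1$; $x\to(y\to z)=(x\wedge y)\to z$; $x\wedge(x\to y)=x\wedge(\sim x\vee y)$. It is five-valued if it satisfies $((x\to z)\to y)\to(((y\to x)\to y)\to y)=1$. $F(n)$ is the free algebra on $n$ free generators in the variety of five-valued Nelson algebras. $C_5$ is the chain $0<\tfrac14<\tfrac12<\tfrac34<1$ with lattice operations min and max, $\sim x=1-x$, and $x\to y=1$ if $x\le y$ or $x\le \sim x$, and $x\to y=\sim x\vee y$ otherwise; it is a five-valued Nelson algebra. -}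

module Defs where

open import Data.Nat using (ℕ)
open import Data.Fin using (Fin)
open import Data.Product using (_×_; ∃)
open import Relation.Binary.PropositionalEquality using (_≡_)
open import Relation.Nullary using (¬_)

data Term (n : ℕ) : Set where
  gen  : Fin n → Term n
  one  : Term n
  ∼_   : Term n → Term n
  _∧_  : Term n → Term n → Term n
  _∨_  : Term n → Term n → Term n
  _⇒_  : Term n → Term n → Term n

infixr 4 _⇒_
infixr 5 _∨_
infixr 6 _∧_
infix 7 ∼_

-- F(n) is the quotient Term n / _≋_, represented as a setoid.

infix 3 _≋_
data _≋_ {n : ℕ} : Term n → Term n → Set where
  ≋-refl  : ∀ {x} → x ≋ x
  ≋-sym   : ∀ {x y} → x ≋ y → y ≋ x
  ≋-trans : ∀ {x y z} → x ≋ y → y ≋ z → x ≋ z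
  ≋-∼     : ∀ {x x'} → x ≋ x' → ∼ x ≋ ∼ x'
  ≋-∧     : ∀ {x x' y y'} → x ≋ x' → y ≋ y' → x ∧ y ≋ x' ∧ y'
  ≋-∨     : ∀ {x x' y y'} → x ≋ x' → y ≋ y' → x ∨ y ≋ x' ∨ y'
  ≋-⇒     : ∀ {x x' y y'} → x ≋ x' → y ≋ y' → (x ⇒ y) ≋ (x' ⇒ y')
  ax1 : ∀ x y → x ∧ (x ∨ y) ≋ x
  ax2 : ∀ x y z → x ∧ (y ∨ z) ≋ (z ∧ x) ∨ (y ∧ x)
  ax3 : ∀ x → ∼ ∼ x ≋ x
  ax4 : ∀ x y → ∼ (x ∨ y) ≋ ∼ x ∨ ∼ y
  ax5 : ∀ x y → x ∧ ∼ x ≋ (x ∧ ∼ x) ∧ (y ∨ ∼ y)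
  ax6 : ∀ x → (x ⇒ x) ≋ one
  ax7 : ∀ x y z → (x ⇒ (y ⇒ z)) ≋ ((x ∧ y) ⇒ z)
  ax8 : ∀ x y → x ∧ (x ⇒ y) ≋ x ∧ (∼ x ∨ y)
  -- five-valuedness
  ax9 : ∀ x y z → (((x ⇒ z) ⇒ y) ⇒ (((y ⇒ x) ⇒ y) ⇒ y)) ≋ one

data C5 : Set where
  c0 c¼ c½ c¾ c1 : C5

rank : C5 → ℕ
rank c0 = 0
rank c¼ = 1
rank c½ = 2
rank c¾ = 3
rank c1 = 4

open import Data.Nat using (_≤ᵇ_)
open import Data.Bool using (Bool; true; false; if_then_else_)
  renaming (_∨_ to _or_)

_≤C_ : C5 → C5 → Bool
a ≤C b = rank a ≤ᵇ rank b

minC maxC : C5 → C5 → C5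
minC a b = if a ≤C b then a else b
maxC a b = if a ≤C b then b else a

negC : C5 → C5
negC c0 = c1
negC c¼ = c¾
negC c½ = c½
negC c¾ = c¼
negC c1 = c0

impC : C5 → C5 → C5
impC a b = if (a ≤C b) or (a ≤C negC a) then c1 else maxC (negC a) b

-- The unique homomorphism f̄ : F(n) → C₅ extending f : G → C₅
-- (on representatives; it respects _≋_ since C₅ is a five-valued
-- Nelson algebra).

ext : ∀ {n} → (Fin n → C5) → Term n → C5
ext f (gen i) = f i
ext f one     = c1
ext f (∼ x)   = negC (ext f x)
ext f (x ∧ y) = minC (ext f x) (ext f y)
ext f (x ∨ y) = maxC (ext f x) (ext f y)
ext f (x ⇒ y) = impC (ext f x) (ext f y)

P : ∀ {n} → (Fin n → C5) → Term n → Set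
P f x = ext f x ≡ c1

_⊊_ : ∀ {n} → (Term n → Set) → (Term n → Set) → Set
A ⊊ B = (∀ x → A x → B x) × ∃ λ x → B x × ¬ A x

-- The map retract : C₅ → C₅ collapsing ¼ to 0 and ¾ to 1 is an endomorphism
-- of C₅.  If f = retract ∘ h then f̄ = retract ∘ h̄, so P_h ⊆ P_f; if moreover
-- f ≠ h, some hᵢ lies in {¼, ¾} and a unary term separates P_f from P_h at gᵢ.
-- Conversely, for each a ∈ C₅ there is a unary term χ a with (χ a)(b) = 1 iff
-- b = retract a, and (χ a)(a) ≥ ¾.  Given P_h ⊆ P_f and s ∈ P_f ∖ P_h we have
-- h̄(s) ≤ ¾, so s → (χ hᵢ)(gᵢ) lies in P_h, hence in P_f; as f̄(s) = 1 this says
-- (χ hᵢ)(fᵢ) = 1, that is fᵢ = retract hᵢ.  Conditions (1)–(5) describe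
-- f = retract ∘ h ≠ h coordinatewise.
module Submission where

open import Defs
open import Data.Nat using (ℕ; _≤_)
import Data.Nat as ℕ
open import Data.Fin using (Fin; zero)
open import Data.Fin.Properties using (¬∀⟶∃¬)
open import Data.List using (List; []; _∷_)
open import Data.List.Membership.Propositional using (_∈_)
open import Data.List.Relation.Unary.Any using (here; there)
open import Data.List.Relation.Unary.All as All using (all?)
open import Data.Product using (_×_; ∃; _,_; proj₂)
open import Data.Sum using (_⊎_; inj₁; inj₂)
open import Function using (_∘_; const)
open import Function.Bundles using (_⇔_; mk⇔; Equivalence)
open import Relation.Binary.Definitions using (DecidableEquality)
open import Relation.Binary.PropositionalEquality
  using (_≡_; _≢_; _≗_; refl; sym; trans; cong; cong₂; module ≡-Reasoning)
open import Relation.Nullary using (¬_; Dec)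
open import Relation.Nullary.Decidable using (True; toWitness; map′; ¬?; _→-dec_)

fromRank : ℕ → C5
fromRank 0 = c0
fromRank 1 = c¼
fromRank 2 = c½
fromRank 3 = c¾
fromRank _ = c1

fromRank-rank : ∀ a → fromRank (rank a) ≡ a
fromRank-rank c0 = refl
fromRank-rank c¼ = refl
fromRank-rank c½ = refl
fromRank-rank c¾ = refl
fromRank-rank c1 = refl

rank-injective : ∀ {a b} → rank a ≡ rank b → a ≡ b
rank-injective {a} {b} eq =
  trans (sym (fromRank-rank a)) (trans (cong fromRank eq) (fromRank-rank b))

_≟_ : DecidableEquality C5
a ≟ b = map′ rank-injective (cong rank) (rank a ℕ.≟ rank b)

elements : List C5
elements = c0 ∷ c¼ ∷ c½ ∷ c¾ ∷ c1 ∷ []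

∈-elements : ∀ a → a ∈ elements
∈-elements c0 = here refl
∈-elements c¼ = there (here refl)
∈-elements c½ = there (there (here refl))
∈-elements c¾ = there (there (there (here refl)))
∈-elements c1 = there (there (there (there (here refl))))

by-evaluation₂ : {Q : C5 → C5 → Set} (Q? : ∀ a b → Dec (Q a b)) →
                 {True (all? (λ a → all? (Q? a) elements) elements)} →
                 ∀ a b → Q a b
by-evaluation₂ Q? {ok} a b =
  All.lookup (All.lookup (toWitness ok) (∈-elements a)) (∈-elements b)

⇒-identityˡ : ∀ a → impC c1 a ≡ a
⇒-identityˡ c0 = refl
⇒-identityˡ c¼ = refl
⇒-identityˡ c½ = refl
⇒-identityˡ c¾ = refl
⇒-identityˡ c1 = refl

record IsEndomorphism (g : C5 → C5) : Set where
  field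
    one-homo : g c1 ≡ c1
    ∼-homo   : ∀ a → g (negC a) ≡ negC (g a)
    ∧-homo   : ∀ a b → g (minC a b) ≡ minC (g a) (g b)
    ∨-homo   : ∀ a b → g (maxC a b) ≡ maxC (g a) (g b)
    ⇒-homo   : ∀ a b → g (impC a b) ≡ impC (g a) (g b)

module _ {g : C5 → C5} (g-endo : IsEndomorphism g) {n : ℕ} (f : Fin n → C5) where
  open IsEndomorphism g-endo

  ext-homo : ∀ t → ext (g ∘ f) t ≡ g (ext f t)
  ext-homo (gen i) = refl
  ext-homo one     = sym one-homo
  ext-homo (∼ t)   = trans (cong negC (ext-homo t)) (sym (∼-homo _))
  ext-homo (t ∧ u) = trans (cong₂ minC (ext-homo t) (ext-homo u)) (sym (∧-homo _ _))
  ext-homo (t ∨ u) = trans (cong₂ maxC (ext-homo t) (ext-homo u)) (sym (∨-homo _ _))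
  ext-homo (t ⇒ u) = trans (cong₂ impC (ext-homo t) (ext-homo u)) (sym (⇒-homo _ _))

ext-cong : ∀ {n} {f h : Fin n → C5} → f ≗ h → ∀ t → ext f t ≡ ext h t
ext-cong f≗h (gen i) = f≗h i
ext-cong f≗h one     = refl
ext-cong f≗h (∼ t)   = cong negC (ext-cong f≗h t)
ext-cong f≗h (t ∧ u) = cong₂ minC (ext-cong f≗h t) (ext-cong f≗h u)
ext-cong f≗h (t ∨ u) = cong₂ maxC (ext-cong f≗h t) (ext-cong f≗h u)
ext-cong f≗h (t ⇒ u) = cong₂ impC (ext-cong f≗h t) (ext-cong f≗h u)

substitute : ∀ {m n} → (Fin m → Term n) → Term m → Term n
substitute σ (gen i) = σ i
substitute σ one     = one
substitute σ (∼ t)   = ∼ substitute σ t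
substitute σ (t ∧ u) = substitute σ t ∧ substitute σ u
substitute σ (t ∨ u) = substitute σ t ∨ substitute σ u
substitute σ (t ⇒ u) = substitute σ t ⇒ substitute σ u

ext-substitute : ∀ {m n} (f : Fin n → C5) (σ : Fin m → Term n) t →
                 ext f (substitute σ t) ≡ ext (ext f ∘ σ) t
ext-substitute f σ (gen i) = refl
ext-substitute f σ one     = refl
ext-substitute f σ (∼ t)   = cong negC (ext-substitute f σ t)
ext-substitute f σ (t ∧ u) = cong₂ minC (ext-substitute f σ t) (ext-substitute f σ u)
ext-substitute f σ (t ∨ u) = cong₂ maxC (ext-substitute f σ t) (ext-substitute f σ u)
ext-substitute f σ (t ⇒ u) = cong₂ impC (ext-substitute f σ t) (ext-substitute f σ u)

retract : C5 → C5
retract c0 = c0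
retract c¼ = c0
retract c½ = c½
retract c¾ = c1
retract c1 = c1

retract-∼ : ∀ a → retract (negC a) ≡ negC (retract a)
retract-∼ c0 = refl
retract-∼ c¼ = refl
retract-∼ c½ = refl
retract-∼ c¾ = refl
retract-∼ c1 = refl

retract-isEndomorphism : IsEndomorphism retract
retract-isEndomorphism = record
  { one-homo = refl
  ; ∼-homo   = retract-∼
  ; ∧-homo   = by-evaluation₂ λ a b → retract (minC a b) ≟ minC (retract a) (retract b)
  ; ∨-homo   = by-evaluation₂ λ a b → retract (maxC a b) ≟ maxC (retract a) (retract b)
  ; ⇒-homo   = by-evaluation₂ λ a b → retract (impC a b) ≟ impC (retract a) (retract b)
  }

-- On the middle class: x → ∼x is 1 iff x ≤ ½, and ∼x → x is 1 iff x ≥ ½.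
χ : C5 → Term 1
χ c0 = ∼ gen zero
χ c¼ = ∼ gen zero
χ c½ = (gen zero ⇒ ∼ gen zero) ∧ (∼ gen zero ⇒ gen zero)
χ c¾ = gen zero
χ c1 = gen zero

χ-retract : ∀ a → ext (const (retract a)) (χ a) ≡ c1
χ-retract c0 = refl
χ-retract c¼ = refl
χ-retract c½ = refl
χ-retract c¾ = refl
χ-retract c1 = refl

χ-one⇒retract : ∀ a b → ext (const b) (χ a) ≡ c1 → b ≡ retract a
χ-one⇒retract =
  by-evaluation₂ λ a b → (ext (const b) (χ a) ≟ c1) →-dec (b ≟ retract a)

⇒-χ-self : ∀ a y → y ≢ c1 → impC y (ext (const a) (χ a)) ≡ c1
⇒-χ-self =
  by-evaluation₂ λ a y → ¬? (y ≟ c1) →-dec (impC y (ext (const a) (χ a)) ≟ c1)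

χ-at : ∀ {n} → Fin n → C5 → Term n
χ-at i a = substitute (const (gen i)) (χ a)

ext-χ-at : ∀ {n} (f : Fin n → C5) i a → ext f (χ-at i a) ≡ ext (const (f i)) (χ a)
ext-χ-at f i a = ext-substitute f _ (χ a)

module _ {n : ℕ} {f h : Fin n → C5} where
  open ≡-Reasoning

  ⊊⇒≗retract : P h ⊊ P f → f ≗ retract ∘ h
  ⊊⇒≗retract (h⊆f , s , fs≡1 , hs≢1) i = χ-one⇒retract (h i) (f i) χ-f
    where
    t : Term n
    t = s ⇒ χ-at i (h i)

    t∈Ph : P h t
    t∈Ph = trans (cong (impC (ext h s)) (ext-χ-at h i (h i)))
                 (⇒-χ-self (h i) (ext h s) hs≢1)

    χ-f : ext (const (f i)) (χ (h i)) ≡ c1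
    χ-f = begin
      ext (const (f i)) (χ (h i))           ≡⟨ sym (⇒-identityˡ _) ⟩
      impC c1 (ext (const (f i)) (χ (h i))) ≡⟨ cong₂ impC (sym fs≡1) (sym (ext-χ-at f i (h i))) ⟩
      ext f t                               ≡⟨ h⊆f t t∈Ph ⟩
      c1                                    ∎

  ⊊⇒differs : P h ⊊ P f → ∃ λ i → f i ≢ h i
  ⊊⇒differs (_ , s , fs≡1 , hs≢1) =
    ¬∀⟶∃¬ n _ (λ i → f i ≟ h i)
      (λ f≗h → hs≢1 (trans (sym (ext-cong f≗h s)) fs≡1))

  ≗retract⇒⊆ : f ≗ retract ∘ h → ∀ x → P h x → P f x
  ≗retract⇒⊆ f≗ x hx = begin
    ext f x             ≡⟨ ext-cong f≗ x ⟩
    ext (retract ∘ h) x ≡⟨ ext-homo retract-isEndomorphism h x ⟩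
    retract (ext h x)   ≡⟨ cong retract hx ⟩
    c1                  ∎

  ≗retract⇒separated : f ≗ retract ∘ h → ∀ i → f i ≢ h i →
                       P f (χ-at i (h i)) × ¬ P h (χ-at i (h i))
  ≗retract⇒separated f≗ i fi≢hi = fχ≡1 , hχ≢1
    where
    fχ≡1 : P f (χ-at i (h i))
    fχ≡1 = begin
      ext f (χ-at i (h i))                  ≡⟨ ext-χ-at f i (h i) ⟩
      ext (const (f i)) (χ (h i))           ≡⟨ cong (λ b → ext (const b) (χ (h i))) (f≗ i) ⟩
      ext (const (retract (h i))) (χ (h i)) ≡⟨ χ-retract (h i) ⟩
      c1                                    ∎

    hχ≢1 : ¬ P h (χ-at i (h i))
    hχ≢1 hχ≡1 = fi≢hi (trans (f≗ i) (sym (χ-one⇒retract (h i) (h i)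
                  (trans (sym (ext-χ-at h i (h i))) hχ≡1))))

  ⊊⇔≗retract : P h ⊊ P f ⇔ ((f ≗ retract ∘ h) × (∃ λ i → f i ≢ h i))
  ⊊⇔≗retract = mk⇔
    (λ h⊊f → ⊊⇒≗retract h⊊f , ⊊⇒differs h⊊f)
    (λ (f≗ , i , fi≢hi) → ≗retract⇒⊆ f≗ , χ-at i (h i) , ≗retract⇒separated f≗ i fi≢hi)

≡retract⇒image : ∀ {a b} → b ≡ retract a → b ≡ c0 ⊎ b ≡ c½ ⊎ b ≡ c1
≡retract⇒image {c0} refl = inj₁ refl
≡retract⇒image {c¼} refl = inj₁ refl
≡retract⇒image {c½} refl = inj₂ (inj₁ refl)
≡retract⇒image {c¾} refl = inj₂ (inj₂ refl)
≡retract⇒image {c1} refl = inj₂ (inj₂ refl)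

≡retract⇒lower : ∀ {a b} → b ≡ retract a → b ≡ c0 → a ≡ c0 ⊎ a ≡ c¼
≡retract⇒lower {c0} refl _ = inj₁ refl
≡retract⇒lower {c¼} refl _ = inj₂ refl

≡retract⇒upper : ∀ {a b} → b ≡ retract a → b ≡ c1 → a ≡ c1 ⊎ a ≡ c¾
≡retract⇒upper {c¾} refl _ = inj₂ refl
≡retract⇒upper {c1} refl _ = inj₁ refl

≡retract⇒middle : ∀ {a b} → b ≡ retract a → (a ≡ c½ → b ≡ c½) × (b ≡ c½ → a ≡ c½)
≡retract⇒middle {c½} refl = (λ _ → refl) , (λ _ → refl)
≡retract⇒middle {c0} refl = (λ ()) , (λ ())
≡retract⇒middle {c¼} refl = (λ ()) , (λ ())
≡retract⇒middle {c¾} refl = (λ ()) , (λ ())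
≡retract⇒middle {c1} refl = (λ ()) , (λ ())

conditions⇒≡retract : ∀ {a b} → b ≡ c0 ⊎ b ≡ c½ ⊎ b ≡ c1 → (b ≡ c0 → a ≡ c0 ⊎ a ≡ c¼) →
                      (b ≡ c1 → a ≡ c1 ⊎ a ≡ c¾) → (b ≡ c½ → a ≡ c½) → b ≡ retract a
conditions⇒≡retract (inj₁ refl) lower _ _ with lower refl
... | inj₁ refl = refl
... | inj₂ refl = refl
conditions⇒≡retract (inj₂ (inj₁ refl)) _ _ middle with middle refl
... | refl = refl
conditions⇒≡retract (inj₂ (inj₂ refl)) _ upper _ with upper refl
... | inj₁ refl = refl
... | inj₂ refl = refl

theorem4p8 : (n : ℕ) → 1 ≤ n → (f h : Fin n → C5) →
    (P h ⊊ P f) ⇔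
      ( (∀ i → f i ≡ c0 ⊎ f i ≡ c½ ⊎ f i ≡ c1)
      × (∃ λ i → ¬ (f i ≡ h i))
      × (∀ i → f i ≡ c0 → h i ≡ c0 ⊎ h i ≡ c¼)
      × (∀ i → f i ≡ c1 → h i ≡ c1 ⊎ h i ≡ c¾)
      × (∀ i → (h i ≡ c½ → f i ≡ c½) × (f i ≡ c½ → h i ≡ c½)) )
theorem4p8 n _ f h = mk⇔
  (λ h⊊f → let (f≗ , differs) = Equivalence.to ⊊⇔≗retract h⊊f in
    (λ i → ≡retract⇒image (f≗ i)) , differs , (λ i → ≡retract⇒lower (f≗ i)) ,
    (λ i → ≡retract⇒upper (f≗ i)) , (λ i → ≡retract⇒middle (f≗ i)))
  (λ (image , differs , lower , upper , middle) → Equivalence.from ⊊⇔≗retract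
    ((λ i → conditions⇒≡retract (image i) (lower i) (upper i) (proj₂ (middle i))) , differs))
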